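{- Let $s,t,D\ge1$ and let $\mathcal G$ be an $s$-joined graph family on vertex set $V$, with auxiliary bipartite graph $B_{\mathcal G}$ having vertex classes $U=V\times[t]$ and $V$. Suppose $Y_0\subseteq V$ satisfies $|Y_0|\ge 3sD+4s$. Then there exists $U_0\subseteq U$ with $|U_0|\le s$ such that for every $X\subseteq U\setminus U_0$ with $|X|\le 2s$, $|N^*(X,Y_0\setminus U_0|_V)|\ge D|X|$.
   Context: $\mathcal G=\{G_1,\dots,G_t\}$ is a family of graphs on common vertex set $V$. $B_{\mathcal G}$ has $(u,i)\in U$ adjacent to $v\in V$ iff $uv\in E(G_i)$. $\mathcal G$ is $s$-joined if for all $X\subseteq U$, $Y\subseteq V$ with $|X|,|Y|\ge s$ there is an edge of $B_{\mathcal G}$ between $X$ and $Y$. For $X\subseteq U$, $X|_V=\{v\in V:(v,i)\in X\text{ for some }i\}$. For $X\subseteq U$ and $Y\subseteq V$, $N(X,Y)$ is the set of vertices of $Y$ adjacent in $B_{\mathcal G}$ to some element of $X$, and $N^*(X,Y)=N(X,Y)\setminus X|_V$. -}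

module Defs where

open import Data.Nat using (ℕ; zero; suc; _+_)
open import Data.Bool using (Bool; true; false; _∧_; _∨_)
open import Data.Fin using (Fin; zero; suc)
open import Data.Fin.Subset using (Subset; _∈_; _∪_; _─_; ∣_∣; ⊥; _⊆_; ∁)
open import Data.Vec using (lookup; tabulate)
open import Data.Product using (Σ; _×_)
open import Relation.Binary.PropositionalEquality using (_≡_)

record Graph (n : ℕ) : Set where
  field
    adj   : Fin n → Fin n → Bool
    sym   : ∀ u v → adj u v ≡ adj v u
    irrefl : ∀ v → adj v v ≡ false
open Graph public

Family : ℕ → ℕ → Set
Family n t = Fin t → Graph n

-- A subset X of U = V × [t] is encoded by its slices:
-- X i = { v ∈ V : (v , i) ∈ X }.
USubset : ℕ → ℕ → Set
USubset n t = Fin t → Subset n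

sumFin : ∀ {k} → (Fin k → ℕ) → ℕ
sumFin {zero}  f = 0
sumFin {suc k} f = f zero + sumFin (λ i → f (suc i))

anyFin : ∀ {k} → (Fin k → Bool) → Bool
anyFin {zero}  f = false
anyFin {suc k} f = f zero ∨ anyFin (λ i → f (suc i))

unionFin : ∀ {n k} → (Fin k → Subset n) → Subset n
unionFin {n} {zero}  f = ⊥
unionFin {n} {suc k} f = f zero ∪ unionFin (λ i → f (suc i))

∣_∣ᵤ : ∀ {n t} → USubset n t → ℕ
∣ X ∣ᵤ = sumFin (λ i → ∣ X i ∣)

_⊆U∖_ : ∀ {n t} → USubset n t → USubset n t → Set
X ⊆U∖ U₀ = ∀ i → X i ⊆ ∁ (U₀ i)

restrictV : ∀ {n t} → USubset n t → Subset n
restrictV X = unionFin X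

-- N(X,Y): vertices of Y adjacent in B_G to some element of X;
-- (u,i) ~ v in B_G iff uv ∈ E(G_i).
N : ∀ {n t} → Family n t → USubset n t → Subset n → Subset n
N G X Y = tabulate λ v →
  lookup Y v ∧ anyFin (λ i → anyFin (λ u → lookup (X i) u ∧ adj (G i) u v))

N* : ∀ {n t} → Family n t → USubset n t → Subset n → Subset n
N* G X Y = N G X Y ─ restrictV X

sJoined : ∀ {n t} → ℕ → Family n t → Set
sJoined {n} {t} s G =
  ∀ (X : USubset n t) (Y : Subset n) → s Data.Nat.≤ ∣ X ∣ᵤ → s Data.Nat.≤ ∣ Y ∣ →
  Σ (Fin t) λ i → Σ (Fin n) λ u → Σ (Fin n) λ v →
    (u ∈ X i) × (v ∈ Y) × (adj (G i) u v ≡ true)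

{-# OPTIONS --safe #-}
module Submission where

-- Start from U₀ = ∅ and, as long as some X ⊆ U ∖ U₀ with |X| ≤ 2s has |N*(X, Y₀ ∖ U₀|_V)| < D|X|,
-- replace U₀ by X ∪ U₀. Since N*(X ∪ U₀, Y₀) ⊆ N*(X, Y₀ ∖ U₀|_V) ∪ N*(U₀, Y₀), this preserves
-- |N*(U₀, Y₀)| ≤ D|U₀|. Any Z with |Z| ≤ 3s and |N*(Z, Y₀)| ≤ D|Z| has |Z| < s: otherwise, by
-- s-joinedness, fewer than s vertices of Y₀ avoid N(Z, Y₀), so |Y₀| < s + D|Z| + |Z| ≤ 3sD + 4s.
-- Hence U₀ grows strictly while staying smaller than s, and the process stops.

open import Defs hiding (sym)
open import Data.Bool using (Bool; true; false; _∧_; _∨_)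
open import Data.Bool.Properties using (∧-conicalˡ; ∧-conicalʳ)
open import Data.Empty using (⊥-elim)
open import Data.Fin using (Fin; zero; suc)
open import Data.Fin.Properties using (all?)
open import Data.Fin.Subset using (Subset; _∈_; _∉_; _∪_; _─_; ∣_∣; ⊥; _⊆_; ∁; Empty)
open import Data.Fin.Subset.Properties
  using (_∈?_; _⊆?_; anySubset?; x∈p∪q⁺; x∈p∪q⁻; x∈p∧x∉q⇒x∈p─q; p─q⊆p; p⊆p∪q; q⊆p∪q;
         p⊆q⇒∣p∣≤∣q∣; ∉⊥; ∣⊥∣≡0; Empty-unique; drop-∷-⊆)
open import Data.Nat using (ℕ; zero; suc; _+_; _*_; _≤_; _<_; z≤n; s≤s; z<s; _≤?_; _<?_)
open import Data.Nat.Properties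
open import Algebra.Properties.CommutativeSemigroup +-commutativeSemigroup using (interchange)
open import Data.Nat.Solver using (module +-*-Solver)
open import Data.Product using (Σ; Σ-syntax; ∃; _×_; _,_)
import Data.Product as Product
open import Data.Sum using (inj₁; inj₂)
open import Data.Vec using ([]; _∷_; here; there; lookup; tabulate)
open import Data.Vec.Properties using ([]=⇒lookup; lookup⇒[]=; lookup∘tabulate; tabulate-cong)
import Data.Vec.Functional as Vector
open import Data.Vec.Functional.Properties using (∷-cong)
open import Function using (_∘_; id)
open import Relation.Binary.PropositionalEquality
  using (_≡_; refl; sym; trans; cong; cong₂; subst; subst₂; _≗_; module ≡-Reasoning)
open import Relation.Nullary using (Dec; yes; no; contradiction)
open import Relation.Nullary.Decidable using (_×-dec_)
open import Relation.Unary using (Decidable)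

anyFunction? : {A : Set} → (∀ {P : A → Set} → Decidable P → Dec (∃ P)) →
  ∀ {t} {P : (Fin t → A) → Set} → (∀ {f g} → f ≗ g → P f → P g) → Decidable P → Dec (∃ P)
anyFunction? any? {zero} resp P? with P? (λ ())
... | yes p = yes (_ , p)
... | no ¬p = no λ (f , p) → ¬p (resp (λ ()) p)
anyFunction? any? {suc t} {P} resp P?
  with any? (λ a → anyFunction? any? {t} {P ∘ (a Vector.∷_)}
                                 (resp ∘ ∷-cong refl) (P? ∘ (a Vector.∷_)))
... | yes (a , f , p) = yes (a Vector.∷ f , p)
... | no ∄ = no λ (f , p) → ∄ (f zero , f ∘ suc , resp (∷-cong refl (λ _ → refl)) p)

anyFin⁺ : ∀ {k} (f : Fin k → Bool) {i} → f i ≡ true → anyFin f ≡ true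
anyFin⁺ f {zero}  fi = cong (_∨ anyFin (f ∘ suc)) fi
anyFin⁺ f {suc i} fi with f zero
... | true  = refl
... | false = anyFin⁺ (f ∘ suc) fi

anyFin⁻ : ∀ {k} (f : Fin k → Bool) → anyFin f ≡ true → ∃ λ i → f i ≡ true
anyFin⁻ {zero}  f ()
anyFin⁻ {suc k} f any with f zero in f0
... | true  = zero , f0
... | false = Product.map suc id (anyFin⁻ (f ∘ suc) any)

anyFin-cong : ∀ {k} {f g : Fin k → Bool} → f ≗ g → anyFin f ≡ anyFin g
anyFin-cong {zero}  eq = refl
anyFin-cong {suc k} eq = cong₂ _∨_ (eq zero) (anyFin-cong (eq ∘ suc))

sumFin-cong : ∀ {k} {f g : Fin k → ℕ} → f ≗ g → sumFin f ≡ sumFin g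
sumFin-cong {zero}  eq = refl
sumFin-cong {suc k} eq = cong₂ _+_ (eq zero) (sumFin-cong (eq ∘ suc))

sumFin-+ : ∀ {k} (f g : Fin k → ℕ) → sumFin (λ i → f i + g i) ≡ sumFin f + sumFin g
sumFin-+ {zero}  f g = refl
sumFin-+ {suc k} f g = begin
  f zero + g zero + sumFin (λ i → f (suc i) + g (suc i))
    ≡⟨ cong (f zero + g zero +_) (sumFin-+ (f ∘ suc) (g ∘ suc)) ⟩
  f zero + g zero + (sumFin (f ∘ suc) + sumFin (g ∘ suc))
    ≡⟨ interchange (f zero) (g zero) _ _ ⟩
  sumFin f + sumFin g ∎
  where open ≡-Reasoning

x∈p─q⇒x∉q : ∀ {n} {x : Fin n} {p q} → x ∈ p ─ q → x ∉ q
x∈p─q⇒x∉q {p = _ ∷ _} ()         here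
x∈p─q⇒x∉q {p = _ ∷ _} (there x∈) (there x∈q) = x∈p─q⇒x∉q x∈ x∈q

p⊆p─q∪q : ∀ {n} {p : Subset n} q → p ⊆ (p ─ q) ∪ q
p⊆p─q∪q q {x} x∈p with x ∈? q
... | yes x∈q = x∈p∪q⁺ (inj₂ x∈q)
... | no  x∉q = x∈p∪q⁺ (inj₁ (x∈p∧x∉q⇒x∈p─q x∈p x∉q))

∣p∪q∣≤∣p∣+∣q∣ : ∀ {n} (p q : Subset n) → ∣ p ∪ q ∣ ≤ ∣ p ∣ + ∣ q ∣
∣p∪q∣≤∣p∣+∣q∣ []          []          = z≤n
∣p∪q∣≤∣p∣+∣q∣ (true ∷ p)  (true ∷ q)  =
  s≤s (≤-trans (∣p∪q∣≤∣p∣+∣q∣ p q) (+-monoʳ-≤ ∣ p ∣ (n≤1+n ∣ q ∣)))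
∣p∪q∣≤∣p∣+∣q∣ (true ∷ p)  (false ∷ q) = s≤s (∣p∪q∣≤∣p∣+∣q∣ p q)
∣p∪q∣≤∣p∣+∣q∣ (false ∷ p) (true ∷ q)  =
  subst (suc ∣ p ∪ q ∣ ≤_) (sym (+-suc ∣ p ∣ ∣ q ∣)) (s≤s (∣p∪q∣≤∣p∣+∣q∣ p q))
∣p∪q∣≤∣p∣+∣q∣ (false ∷ p) (false ∷ q) = ∣p∪q∣≤∣p∣+∣q∣ p q

∣p∪q∣≡∣p∣+∣q∣ : ∀ {n} {p q : Subset n} → p ⊆ ∁ q → ∣ p ∪ q ∣ ≡ ∣ p ∣ + ∣ q ∣
∣p∪q∣≡∣p∣+∣q∣ {p = []}         {[]}         p⊆∁q = refl
∣p∪q∣≡∣p∣+∣q∣ {p = true ∷ p}   {true ∷ q}   p⊆∁q with () ← p⊆∁q here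
∣p∪q∣≡∣p∣+∣q∣ {p = true ∷ p}   {false ∷ q}  p⊆∁q = cong suc (∣p∪q∣≡∣p∣+∣q∣ (drop-∷-⊆ p⊆∁q))
∣p∪q∣≡∣p∣+∣q∣ {p = false ∷ p}  {true ∷ q}   p⊆∁q =
  trans (cong suc (∣p∪q∣≡∣p∣+∣q∣ (drop-∷-⊆ p⊆∁q))) (sym (+-suc ∣ p ∣ ∣ q ∣))
∣p∪q∣≡∣p∣+∣q∣ {p = false ∷ p}  {false ∷ q}  p⊆∁q = ∣p∪q∣≡∣p∣+∣q∣ (drop-∷-⊆ p⊆∁q)

∈-unionFin⁺ : ∀ {n k} (f : Fin k → Subset n) {i x} → x ∈ f i → x ∈ unionFin f
∈-unionFin⁺ f {zero}  x∈ = x∈p∪q⁺ (inj₁ x∈)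
∈-unionFin⁺ f {suc i} x∈ = x∈p∪q⁺ (inj₂ (∈-unionFin⁺ (f ∘ suc) x∈))

∈-unionFin⁻ : ∀ {n k} (f : Fin k → Subset n) {x} → x ∈ unionFin f → ∃ λ i → x ∈ f i
∈-unionFin⁻ {k = zero}  f x∈ = ⊥-elim (∉⊥ x∈)
∈-unionFin⁻ {k = suc k} f x∈ with x∈p∪q⁻ (f zero) _ x∈
... | inj₁ x∈f₀   = zero , x∈f₀
... | inj₂ x∈rest = Product.map suc id (∈-unionFin⁻ (f ∘ suc) x∈rest)

unionFin-mono : ∀ {n k} {f g : Fin k → Subset n} → (∀ i → f i ⊆ g i) → unionFin f ⊆ unionFin g
unionFin-mono {g = g} f⊆g x∈ with ∈-unionFin⁻ _ x∈
... | i , x∈fᵢ = ∈-unionFin⁺ g (f⊆g i x∈fᵢ)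

unionFin-cong : ∀ {n k} {f g : Fin k → Subset n} → f ≗ g → unionFin f ≡ unionFin g
unionFin-cong {k = zero}  eq = refl
unionFin-cong {k = suc k} eq = cong₂ _∪_ (eq zero) (unionFin-cong (eq ∘ suc))

∣unionFin∣≤sumFin : ∀ {n k} (f : Fin k → Subset n) → ∣ unionFin f ∣ ≤ sumFin (∣_∣ ∘ f)
∣unionFin∣≤sumFin {n} {zero}  f = ≤-reflexive (∣⊥∣≡0 n)
∣unionFin∣≤sumFin {k = suc k} f =
  ≤-trans (∣p∪q∣≤∣p∣+∣q∣ (f zero) _) (+-monoʳ-≤ ∣ f zero ∣ (∣unionFin∣≤sumFin (f ∘ suc)))

⊥ᵤ : ∀ {n t} → USubset n t
⊥ᵤ _ = ⊥

_∪ᵤ_ : ∀ {n t} → USubset n t → USubset n t → USubset n t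
(X ∪ᵤ Y) i = X i ∪ Y i

∣⊥ᵤ∣ᵤ≡0 : ∀ {n t} → ∣ ⊥ᵤ {n} {t} ∣ᵤ ≡ 0
∣⊥ᵤ∣ᵤ≡0 {n} {zero}  = refl
∣⊥ᵤ∣ᵤ≡0 {n} {suc t} = cong₂ _+_ (∣⊥∣≡0 n) (∣⊥ᵤ∣ᵤ≡0 {n} {t})

∣X∪ᵤU∣ᵤ≡∣X∣ᵤ+∣U∣ᵤ : ∀ {n t} {X U : USubset n t} → X ⊆U∖ U → ∣ X ∪ᵤ U ∣ᵤ ≡ ∣ X ∣ᵤ + ∣ U ∣ᵤ
∣X∪ᵤU∣ᵤ≡∣X∣ᵤ+∣U∣ᵤ {X = X} {U} X⊆U∖U =
  trans (sumFin-cong (λ i → ∣p∪q∣≡∣p∣+∣q∣ (X⊆U∖U i))) (sumFin-+ (∣_∣ ∘ X) (∣_∣ ∘ U))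

restrictV-∪ᵤˡ : ∀ {n t} (X U : USubset n t) → restrictV X ⊆ restrictV (X ∪ᵤ U)
restrictV-∪ᵤˡ X U = unionFin-mono λ i → p⊆p∪q (U i)

restrictV-∪ᵤʳ : ∀ {n t} (X U : USubset n t) → restrictV U ⊆ restrictV (X ∪ᵤ U)
restrictV-∪ᵤʳ X U = unionFin-mono λ i → q⊆p∪q (X i) (U i)

module _ {n t} (G : Family n t) where

  Adjacent : USubset n t → Fin n → Set
  Adjacent X v = Σ[ i ∈ Fin t ] Σ[ u ∈ Fin n ] u ∈ X i × adj (G i) u v ≡ true

  adjacent : USubset n t → Fin n → Bool
  adjacent X v = anyFin λ i → anyFin λ u → lookup (X i) u ∧ adj (G i) u v

  adjacent⁺ : ∀ {X v} → Adjacent X v → adjacent X v ≡ true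
  adjacent⁺ {X} {v} (i , u , u∈Xᵢ , uv) =
    anyFin⁺ (λ i → anyFin λ u → lookup (X i) u ∧ adj (G i) u v)
      (anyFin⁺ (λ u → lookup (X i) u ∧ adj (G i) u v) (cong₂ _∧_ ([]=⇒lookup u∈Xᵢ) uv))

  adjacent⁻ : ∀ {X v} → adjacent X v ≡ true → Adjacent X v
  adjacent⁻ {X} {v} X~v
    with i , ∃u ← anyFin⁻ (λ i → anyFin λ u → lookup (X i) u ∧ adj (G i) u v) X~v
    with u , uv ← anyFin⁻ (λ u → lookup (X i) u ∧ adj (G i) u v) ∃u
    = i , u , lookup⇒[]= u (X i) (∧-conicalˡ _ _ uv) , ∧-conicalʳ _ _ uv

  ∈N⁺ : ∀ {X Y v} → v ∈ Y → Adjacent X v → v ∈ N G X Y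
  ∈N⁺ {v = v} v∈Y X~v =
    lookup⇒[]= v _ (trans (lookup∘tabulate _ v) (cong₂ _∧_ ([]=⇒lookup v∈Y) (adjacent⁺ X~v)))

  ∈N⁻ : ∀ {X Y v} → v ∈ N G X Y → v ∈ Y × Adjacent X v
  ∈N⁻ {X} {Y} {v} v∈N =
    lookup⇒[]= v Y (∧-conicalˡ _ _ N[v]) , adjacent⁻ (∧-conicalʳ _ _ N[v])
    where
    N[v] : lookup Y v ∧ adjacent X v ≡ true
    N[v] = trans (sym (lookup∘tabulate _ v)) ([]=⇒lookup v∈N)

  ∈N*⁺ : ∀ {X Y v} → v ∈ Y → Adjacent X v → v ∉ restrictV X → v ∈ N* G X Y
  ∈N*⁺ v∈Y X~v v∉X = x∈p∧x∉q⇒x∈p─q (∈N⁺ v∈Y X~v) v∉X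

  ∈N*⁻ : ∀ {X Y v} → v ∈ N* G X Y → (v ∈ Y × Adjacent X v) × v ∉ restrictV X
  ∈N*⁻ {X} {Y} v∈N* = ∈N⁻ (p─q⊆p (N G X Y) _ v∈N*) , x∈p─q⇒x∉q v∈N*

  N*-cong : ∀ {X X′} Y → X ≗ X′ → N* G X Y ≡ N* G X′ Y
  N*-cong Y X≗X′ = cong₂ _─_
    (tabulate-cong λ v → cong (lookup Y v ∧_) (anyFin-cong λ i → anyFin-cong λ u →
      cong (λ Xᵢ → lookup Xᵢ u ∧ adj (G i) u v) (X≗X′ i)))
    (unionFin-cong X≗X′)

  ∣N∣≤∣N*∣+∣X∣ᵤ : ∀ X Y → ∣ N G X Y ∣ ≤ ∣ N* G X Y ∣ + ∣ X ∣ᵤ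
  ∣N∣≤∣N*∣+∣X∣ᵤ X Y = begin
    ∣ N G X Y ∣                         ≤⟨ p⊆q⇒∣p∣≤∣q∣ (p⊆p─q∪q {p = N G X Y} (restrictV X)) ⟩
    ∣ N* G X Y ∪ restrictV X ∣          ≤⟨ ∣p∪q∣≤∣p∣+∣q∣ (N* G X Y) (restrictV X) ⟩
    ∣ N* G X Y ∣ + ∣ restrictV X ∣      ≤⟨ +-monoʳ-≤ ∣ N* G X Y ∣ (∣unionFin∣≤sumFin X) ⟩
    ∣ N* G X Y ∣ + ∣ X ∣ᵤ               ∎
    where open ≤-Reasoning

  N*-∪ᵤ-⊆ : ∀ X U Y → N* G (X ∪ᵤ U) Y ⊆ N* G X (Y ─ restrictV U) ∪ N* G U Y
  N*-∪ᵤ-⊆ X U Y v∈N*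
    with (v∈Y , i , u , u∈Xᵢ∪Uᵢ , uv) , v∉X∪U ← ∈N*⁻ v∈N*
    with x∈p∪q⁻ (X i) (U i) u∈Xᵢ∪Uᵢ
  ... | inj₁ u∈Xᵢ = x∈p∪q⁺ (inj₁ (∈N*⁺ {Y = Y ─ restrictV U}
                      (x∈p∧x∉q⇒x∈p─q v∈Y (v∉X∪U ∘ restrictV-∪ᵤʳ X U))
                      (i , u , u∈Xᵢ , uv) (v∉X∪U ∘ restrictV-∪ᵤˡ X U)))
  ... | inj₂ u∈Uᵢ = x∈p∪q⁺ (inj₂ (∈N*⁺ {Y = Y}
                      v∈Y (i , u , u∈Uᵢ , uv) (v∉X∪U ∘ restrictV-∪ᵤʳ X U)))

  ∣N*⊥ᵤ∣≡0 : ∀ Y → ∣ N* G ⊥ᵤ Y ∣ ≡ 0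
  ∣N*⊥ᵤ∣≡0 Y = trans (cong ∣_∣ (Empty-unique N*⊥ᵤ-empty)) (∣⊥∣≡0 n)
    where
    N*⊥ᵤ-empty : Empty (N* G ⊥ᵤ Y)
    N*⊥ᵤ-empty (v , v∈N*) with (_ , _ , _ , u∈⊥ , _) , _ ← ∈N*⁻ {Y = Y} v∈N* = ∉⊥ u∈⊥

  sJoined⇒∣Y∣<s+∣N∣ : ∀ {s} → sJoined s G →
                      ∀ {X} → s ≤ ∣ X ∣ᵤ → ∀ Y → ∣ Y ∣ < s + ∣ N G X Y ∣
  sJoined⇒∣Y∣<s+∣N∣ {s} joined {X} s≤∣X∣ Y = begin-strict
    ∣ Y ∣                            ≤⟨ p⊆q⇒∣p∣≤∣q∣ (p⊆p─q∪q {p = Y} (N G X Y)) ⟩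
    ∣ (Y ─ N G X Y) ∪ N G X Y ∣      ≤⟨ ∣p∪q∣≤∣p∣+∣q∣ (Y ─ N G X Y) (N G X Y) ⟩
    ∣ Y ─ N G X Y ∣ + ∣ N G X Y ∣    <⟨ +-monoˡ-< ∣ N G X Y ∣ ∣Y─N∣<s ⟩
    s + ∣ N G X Y ∣                  ∎
    where
    open ≤-Reasoning
    ∣Y─N∣<s : ∣ Y ─ N G X Y ∣ < s
    ∣Y─N∣<s = ≰⇒> λ s≤∣Y─N∣ →
      let i , u , v , u∈Xᵢ , v∈Y─N , uv = joined X (Y ─ N G X Y) s≤∣X∣ s≤∣Y─N∣ in
      x∈p─q⇒x∉q v∈Y─N (∈N⁺ {X} (p─q⊆p Y (N G X Y) v∈Y─N) (i , u , u∈Xᵢ , uv))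

<m*n⇒0<n : ∀ {k} m n → k < m * n → 0 < n
<m*n⇒0<n {k} m zero k<m*0 = contradiction (subst (k <_) (*-zeroʳ m) k<m*0) λ ()
<m*n⇒0<n     m (suc n) _ = z<s

module Construction {n t} (s D : ℕ) (G : Family n t) (joined : sJoined s G)
                    (Y₀ : Subset n) (∣Y₀∣-large : 3 * s * D + 4 * s ≤ ∣ Y₀ ∣) where

  NonExpanding : USubset n t → Set
  NonExpanding Z = ∣ N* G Z Y₀ ∣ ≤ D * ∣ Z ∣ᵤ

  Counterexample : USubset n t → USubset n t → Set
  Counterexample U X = X ⊆U∖ U × ∣ X ∣ᵤ ≤ 2 * s × ∣ N* G X (Y₀ ─ restrictV U) ∣ < D * ∣ X ∣ᵤ

  Conclusion : USubset n t → Set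
  Conclusion U = (X : USubset n t) → X ⊆U∖ U → ∣ X ∣ᵤ ≤ 2 * s →
    D * ∣ X ∣ᵤ ≤ ∣ N* G X (Y₀ ─ restrictV U) ∣

  counterexample? : ∀ U → Dec (∃ (Counterexample U))
  counterexample? U = anyFunction? anySubset? respects decide
    where
    respects : ∀ {X X′} → X ≗ X′ → Counterexample U X → Counterexample U X′
    respects {X} {X′} X≗X′ (X⊆ , ∣X∣≤2s , N*<) =
      (λ i → subst (_⊆ ∁ (U i)) (X≗X′ i) (X⊆ i)) ,
      subst (_≤ 2 * s) ∣X∣≡∣X′∣ ∣X∣≤2s ,
      subst₂ (λ A k → ∣ A ∣ < D * k) (N*-cong G (Y₀ ─ restrictV U) X≗X′) ∣X∣≡∣X′∣ N*<
      where
      ∣X∣≡∣X′∣ : ∣ X ∣ᵤ ≡ ∣ X′ ∣ᵤ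
      ∣X∣≡∣X′∣ = sumFin-cong (cong ∣_∣ ∘ X≗X′)
    decide : ∀ X → Dec (Counterexample U X)
    decide X = all? (λ i → X i ⊆? ∁ (U i)) ×-dec ∣ X ∣ᵤ ≤? 2 * s
           ×-dec ∣ N* G X (Y₀ ─ restrictV U) ∣ <? D * ∣ X ∣ᵤ

  nonExpanding⇒small : ∀ {Z} → ∣ Z ∣ᵤ ≤ 3 * s → NonExpanding Z → ∣ Z ∣ᵤ < s
  nonExpanding⇒small {Z} ∣Z∣≤3s ne = ≰⇒> λ s≤∣Z∣ → n≮n ∣ Y₀ ∣ (begin-strict
    ∣ Y₀ ∣                         <⟨ sJoined⇒∣Y∣<s+∣N∣ G joined {Z} s≤∣Z∣ Y₀ ⟩
    s + ∣ N G Z Y₀ ∣               ≤⟨ +-monoʳ-≤ s (∣N∣≤∣N*∣+∣X∣ᵤ G Z Y₀) ⟩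
    s + (∣ N* G Z Y₀ ∣ + ∣ Z ∣ᵤ)   ≤⟨ +-monoʳ-≤ s (+-mono-≤ ne ∣Z∣≤3s) ⟩
    s + (D * ∣ Z ∣ᵤ + 3 * s)       ≤⟨ +-monoʳ-≤ s (+-monoˡ-≤ (3 * s) (*-monoʳ-≤ D ∣Z∣≤3s)) ⟩
    s + (D * (3 * s) + 3 * s)      ≡⟨ solve 2 (λ s D → s :+ (D :* (con 3 :* s) :+ con 3 :* s)
                                                    := con 3 :* s :* D :+ con 4 :* s) refl s D ⟩
    3 * s * D + 4 * s              ≤⟨ ∣Y₀∣-large ⟩
    ∣ Y₀ ∣                         ∎)
    where
    open ≤-Reasoning
    open +-*-Solver

  extend : ∀ {U X} → ∣ U ∣ᵤ ≤ s → NonExpanding U → Counterexample U X →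
           NonExpanding (X ∪ᵤ U) × ∣ X ∪ᵤ U ∣ᵤ < s × ∣ U ∣ᵤ < ∣ X ∪ᵤ U ∣ᵤ
  extend {U} {X} ∣U∣≤s ne (X⊆ , ∣X∣≤2s , N*<) =
    <⇒≤ ∣N*Z∣<D∣Z∣ , nonExpanding⇒small ∣Z∣≤3s (<⇒≤ ∣N*Z∣<D∣Z∣) , ∣U∣<∣Z∣
    where
    open ≤-Reasoning
    ∣Z∣≡ : ∣ X ∪ᵤ U ∣ᵤ ≡ ∣ X ∣ᵤ + ∣ U ∣ᵤ
    ∣Z∣≡ = ∣X∪ᵤU∣ᵤ≡∣X∣ᵤ+∣U∣ᵤ X⊆
    ∣N*Z∣<D∣Z∣ : ∣ N* G (X ∪ᵤ U) Y₀ ∣ < D * ∣ X ∪ᵤ U ∣ᵤ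
    ∣N*Z∣<D∣Z∣ = begin-strict
      ∣ N* G (X ∪ᵤ U) Y₀ ∣       ≤⟨ p⊆q⇒∣p∣≤∣q∣ (N*-∪ᵤ-⊆ G X U Y₀) ⟩
      ∣ N*X ∪ N*U ∣              ≤⟨ ∣p∪q∣≤∣p∣+∣q∣ N*X N*U ⟩
      ∣ N*X ∣ + ∣ N*U ∣          <⟨ +-mono-<-≤ N*< ne ⟩
      D * ∣ X ∣ᵤ + D * ∣ U ∣ᵤ    ≡⟨ *-distribˡ-+ D ∣ X ∣ᵤ ∣ U ∣ᵤ ⟨
      D * (∣ X ∣ᵤ + ∣ U ∣ᵤ)      ≡⟨ cong (D *_) ∣Z∣≡ ⟨
      D * ∣ X ∪ᵤ U ∣ᵤ            ∎
      where
      N*X = N* G X (Y₀ ─ restrictV U)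
      N*U = N* G U Y₀
    ∣Z∣≤3s : ∣ X ∪ᵤ U ∣ᵤ ≤ 3 * s
    ∣Z∣≤3s = begin
      ∣ X ∪ᵤ U ∣ᵤ        ≡⟨ ∣Z∣≡ ⟩
      ∣ X ∣ᵤ + ∣ U ∣ᵤ    ≤⟨ +-mono-≤ ∣X∣≤2s ∣U∣≤s ⟩
      2 * s + s          ≡⟨ +-comm (2 * s) s ⟩
      3 * s              ∎
    ∣U∣<∣Z∣ : ∣ U ∣ᵤ < ∣ X ∪ᵤ U ∣ᵤ
    ∣U∣<∣Z∣ = subst (∣ U ∣ᵤ <_) (sym ∣Z∣≡) (m<n+m ∣ U ∣ᵤ (<m*n⇒0<n D ∣ X ∣ᵤ N*<))

  grow : ∀ k U → s ≤ k + ∣ U ∣ᵤ → ∣ U ∣ᵤ ≤ s → NonExpanding U →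
         Σ (USubset n t) λ U₀ → ∣ U₀ ∣ᵤ ≤ s × Conclusion U₀
  grow k U fuel ∣U∣≤s ne with counterexample? U
  ... | no ∄X = U , ∣U∣≤s , λ X X⊆ ∣X∣≤2s → ≮⇒≥ λ N*< → ∄X (X , X⊆ , ∣X∣≤2s , N*<)
  grow zero U fuel ∣U∣≤s ne | yes (X , cx) =
    let _ , ∣Z∣<s , ∣U∣<∣Z∣ = extend ∣U∣≤s ne cx in
    contradiction (≤-<-trans fuel (<-trans ∣U∣<∣Z∣ ∣Z∣<s)) (n≮n s)
  grow (suc k) U fuel ∣U∣≤s ne | yes (X , cx) =
    let ne′ , ∣Z∣<s , ∣U∣<∣Z∣ = extend ∣U∣≤s ne cx in
    grow k (X ∪ᵤ U) (≤-trans fuel (subst (_≤ k + ∣ X ∪ᵤ U ∣ᵤ) (+-suc k _) (+-monoʳ-≤ k ∣U∣<∣Z∣)))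
         (<⇒≤ ∣Z∣<s) ne′

  exceptional-set : Σ (USubset n t) λ U₀ → ∣ U₀ ∣ᵤ ≤ s × Conclusion U₀
  exceptional-set = grow s ⊥ᵤ (m≤m+n s _) (≤-trans (≤-reflexive (∣⊥ᵤ∣ᵤ≡0 {n} {t})) z≤n)
                       (≤-trans (≤-reflexive (∣N*⊥ᵤ∣≡0 G Y₀)) z≤n)

proposition3p1 : (n t s D : ℕ) → 1 ≤ s → 1 ≤ t → 1 ≤ D →
    (G : Family n t) → sJoined s G →
    (Y₀ : Subset n) → 3 * s * D + 4 * s ≤ ∣ Y₀ ∣ →
    Σ (USubset n t) λ U₀ → (∣ U₀ ∣ᵤ ≤ s) ×
      ((X : USubset n t) → X ⊆U∖ U₀ → ∣ X ∣ᵤ ≤ 2 * s →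
        D * ∣ X ∣ᵤ ≤ ∣ N* G X (Y₀ ─ restrictV U₀) ∣)
proposition3p1 n t s D _ _ _ G joined Y₀ ∣Y₀∣-large =
  Construction.exceptional-set s D G joined Y₀ ∣Y₀∣-large
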